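{- Let $a\ge 1$ be an integer, let $L\subseteq\{0,1,\dots,a-1\}$ and put $\ell=|L|$. For all integers $n\ge 0$ and $k$, $$g_{a,0,\ell,\ell}(n,k)=\#A_L(n,k)\qquad\text{and}\qquad g_{0,a,\ell-a,\ell}(n,k)=\#B_L(n,k),$$ where $A_L(n,k)=\{\sigma\in C_a\wr S_n : \overleftarrow{\min}_L(\sigma)=k\}$ and $B_L(n,k)=\{\sigma\in C_a\wr S_n : des_L(\sigma)=\overleftarrow{\min}_L(\sigma)=k\}$.
   Context: For integers $A,D,R,\Lambda$ the numbers $g_{A,D,R,\Lambda}(n,k)$ ($n\ge0$, $k\in\mathbb Z$) are defined by $g(0,0)=1$, $g(n,k)=0$ if $k<0$ or $k>n$, and for $n\ge1$, $0\le k\le n$: $g(n,k)=(An+Dk-R)\,g(n-1,k)+\Lambda\, g(n-1,k-1)$. Let $\alpha=e^{2\pi i/a}$ and $C_a=\{\alpha^t:0\le t\le a-1\}$. The wreath product $C_a\wr S_n$ is identified with the group (under composition) of bijections $\sigma$ of $\{\alpha^v j: 0\le v\le a-1,\ 1\le j\le n\}$ satisfying $\sigma(\beta j)=\beta\sigma(j)$ for $\beta\in C_a$; we write $\sigma=[\sigma(1),\dots,\sigma(n)]$, $\sigma(j)=\alpha^{t_j}|\sigma(j)|$ with $|\sigma(j)|\in\{1,\dots,n\}$ ($\alpha^{t_j}$ is the color of $\sigma(j)$), and $|\sigma|=[|\sigma(1)|,\dots,|\sigma(n)|]\in S_n$. We set $\sigma(0)=0$. For $C_a\wr S_0$ (the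 trivial group) all statistics below are $0$. Colored right-to-left minima: $\overleftarrow{\mathrm{Min}}_L(\sigma)$ is the set of values $|\sigma(i)|$ such that $|\sigma(i)|<|\sigma(j)|$ for all $j>i$ (a right-to-left minimum of $|\sigma|$) and $\sigma(i)=\alpha^u|\sigma(i)|$ with $u\in L$; $\overleftarrow{\min}_L(\sigma)=|\overleftarrow{\mathrm{Min}}_L(\sigma)|$. The $L$-order: let $U=\{0,\dots,a-1\}\setminus L$. Define a linear order $<_L$ on $\{\alpha^v j:0\le v\le a-1,1\le j\le n\}\cup\{0\}$ by: $\alpha^v j<_L 0$ if $v\in L$; $\alpha^v j>_L0$ if $v\in U$; for $u,v\in L$ and $i\ne j$, $\alpha^v i<_L\alpha^u j$ iff $i>j$; for $u,v\in U$ and $i\ne j$, $\alpha^v i<_L\alpha^u j$ iff $i<j$; elements $\alpha^v j$ with the same $j$ and $v$ in the same one of $L,U$ are ordered arbitrarily (this does not affect descents below). The $L$-descent set is $Des_L(\sigma)=\{0\le i\le n-1:\sigma(i)>_L\sigma(i+1)\}$ (with $\sigma(0)=0$) and $des_L(\sigma)=|Des_L(\sigma)|$. -}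

module Defs where

open import Data.Bool using (Bool; true; false; if_then_else_; _∧_; not)
open import Data.Nat as ℕ using (ℕ; zero; suc)
open import Data.Integer as ℤ using (ℤ; +_; -[1+_]; 0ℤ; 1ℤ)
open import Data.Fin using (Fin; toℕ)
open import Data.Fin.Subset using (Subset; ∣_∣)
open import Data.Product using (_×_; _,_; proj₁; proj₂)
open import Data.List using (List; []; _∷_; map; length; filter; cartesianProduct; allFin; concatMap)
open import Data.Vec as Vec using (Vec; lookup; toList)
open import Relation.Binary.PropositionalEquality using (_≡_)
open import Relation.Nullary.Decidable using (yes; no)

inRange : ℕ → ℤ → Bool
inRange n k = (0ℤ ℤ.≤ᵇ k) ∧ (k ℤ.≤ᵇ + n)

g : (A D R Λ : ℤ) → ℕ → ℤ → ℤ
g A D R Λ zero    k = if (k ℤ.≤ᵇ 0ℤ) ∧ (0ℤ ℤ.≤ᵇ k) then 1ℤ else 0ℤ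
g A D R Λ (suc n) k =
  if inRange (suc n) k
  then (A ℤ.* + suc n ℤ.+ D ℤ.* k ℤ.- R) ℤ.* g A D R Λ n k
         ℤ.+ Λ ℤ.* g A D R Λ n (k ℤ.- 1ℤ)
  else 0ℤ

-- A word is a vector of length n; entry i is (j , t) meaning
-- σ(i+1) = α^t (j+1), i.e. |σ(i+1)| = toℕ j + 1 and colour α^t.
-- It is an element of C_a ≀ S_n iff |σ| is a permutation, i.e. the
-- absolute values are pairwise distinct.

Entry : ℕ → ℕ → Set
Entry a n = Fin n × Fin a

allVecs : {X : Set} → List X → (m : ℕ) → List (Vec X m)
allVecs xs zero    = Vec.[] ∷ []
allVecs xs (suc m) = concatMap (λ x → map (x Vec.∷_) (allVecs xs m)) xs

absCol : {a n : ℕ} → Vec (Entry a n) n → List (ℕ × Fin a)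
absCol w = map (λ e → suc (toℕ (proj₁ e)) , proj₂ e) (toList w)

notElem : ℕ → List ℕ → Bool
notElem x []       = true
notElem x (y ∷ ys) = not (x ℕ.≡ᵇ y) ∧ notElem x ys

distinct : List ℕ → Bool
distinct []       = true
distinct (x ∷ xs) = notElem x xs ∧ distinct xs

isColPerm : {a n : ℕ} → Vec (Entry a n) n → Bool
isColPerm w = distinct (map proj₁ (absCol w))

colPerms : (a n : ℕ) → List (Vec (Entry a n) n)
colPerms a n = filter (λ w → Data.Bool._≟_ (isColPerm w) true)
                      (allVecs (cartesianProduct (allFin n) (allFin a)) n)
  where import Data.Bool

allB : {X : Set} → (X → Bool) → List X → Bool
allB p []       = true
allB p (x ∷ xs) = p x ∧ allB p xs

rlminL' : {a : ℕ} → Subset a → List (ℕ × Fin a) → ℕ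
rlminL' L []             = 0
rlminL' L ((j , t) ∷ xs) =
  (if allB (λ y → j ℕ.<ᵇ proj₁ y) xs ∧ lookup L t then 1 else 0)
  ℕ.+ rlminL' L xs

rlminL : {a n : ℕ} → Subset a → Vec (Entry a n) n → ℕ
rlminL L w = rlminL' L (absCol w)

-- the L-order is realised by an integer key: 0 ↦ 0,
-- α^v j ↦ -j if v ∈ L, and α^v j ↦ j if v ∉ L.
-- (Elements with the same j and v on the same side get equal keys;
--  they never occur at adjacent positions of a colored permutation.)
keyL : {a : ℕ} → Subset a → ℕ × Fin a → ℤ
keyL L (j , t) = if lookup L t then ℤ.- (+ j) else + j

-- number of i (0 ≤ i ≤ n-1) with σ(i) >_L σ(i+1), where σ(0) = 0
descents : List ℤ → ℕ
descents []           = 0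
descents (x ∷ [])     = 0
descents (x ∷ y ∷ ys) = (if not (x ℤ.≤ᵇ y) then 1 else 0) ℕ.+ descents (y ∷ ys)

desL : {a n : ℕ} → Subset a → Vec (Entry a n) n → ℕ
desL L w = descents (0ℤ ∷ map (keyL L) (absCol w))

_==ℤ_ : ℤ → ℤ → Bool
infix 4 _==ℤ_
x ==ℤ y = (x ℤ.≤ᵇ y) ∧ (y ℤ.≤ᵇ x)

countA : (a : ℕ) → Subset a → ℕ → ℤ → ℕ
countA a L n k = length (filter (λ w → Data.Bool._≟_ ((+ rlminL L w) ==ℤ k) true) (colPerms a n))
  where import Data.Bool

countB : (a : ℕ) → Subset a → ℕ → ℤ → ℕ
countB a L n k = length (filter (λ w → Data.Bool._≟_ (((+ desL L w) ==ℤ k) ∧ ((+ rlminL L w) ==ℤ k)) true) (colPerms a n))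
  where import Data.Bool

-- Every colored permutation of size n + 1 arises exactly once from one of size n by inserting
-- the value n + 1, with one of a colours, at one of n + 1 positions.  The new value is a
-- right-to-left minimum only when it is inserted last, so min_L grows by [c ∈ L] there and is
-- unchanged elsewhere; summing gives #A_L(n+1,k) = (a(n+1) − ℓ) #A_L(n,k) + ℓ #A_L(n,k−1).
-- In the L-order the new value is the largest element if c ∉ L and the smallest if c ∈ L, so
-- des_L grows by [c ∈ L] when it is inserted last, and otherwise by one minus the descent it
-- splits.  As min_L ≤ des_L always (by the same insertion), a permutation with
-- des_L = min_L = k comes either from one with des_L = min_L = k, by inserting into one of its
-- k descents or at the end with c ∉ L, or from one with des_L = min_L = k − 1, by inserting at
-- the end with c ∈ L: #B_L(n+1,k) = (ak + a − ℓ) #B_L(n,k) + ℓ #B_L(n,k−1).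
-- These are the recurrences of g, with the same initial values.

module Submission where

open import Defs
open import Data.Nat using (ℕ; _≤_)
open import Data.Integer using (ℤ; +_; 0ℤ; _-_)
open import Data.Fin.Subset using (Subset; ∣_∣)
open import Data.Product using (_×_)
open import Relation.Binary.PropositionalEquality using (_≡_)

open import Algebra.Bundles using (CommutativeMonoid)
import Algebra.Properties.CommutativeSemigroup as CommutativeSemigroupProperties
open import Data.Bool as Bool using (Bool; true; false; if_then_else_; _∧_; not; T)
open import Data.Bool.Properties using (T-≡; ∧-conicalˡ; ∧-conicalʳ; ∧-zeroʳ; ∧-commutativeMonoid)
open import Data.Fin using (Fin; toℕ; fromℕ; inject₁; lower₁; punchOut; punchIn) renaming (zero to fzero; suc to fsuc)
open import Data.Fin.Properties
  using (toℕ<n; toℕ≤pred[n]; toℕ-inject₁; toℕ-fromℕ; toℕ-lower₁; inject₁-lower₁; inject₁-injective; toℕ-injective;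
         fromℕ≢inject₁; punchIn-punchOut; pigeonhole; any?)
import Data.Fin.Properties as Fin
open import Data.Integer using (-[1+_]; 1ℤ)
import Data.Integer as ℤ
import Data.Integer.Properties as ℤ
open import Data.Integer.Tactic.RingSolver renaming (solve-∀ to ℤ-solve)
open import Data.List
  using (List; []; _∷_; map; length; filter; cartesianProduct; cartesianProductWith; allFin; concatMap; _++_; applyUpTo)
open import Data.List.Properties using (map-++; map-∘; map-tabulate; map-cong; map-cong-local; applyUpTo-∷ʳ; length-map)
open import Data.List.Membership.Propositional using (_∈_)
open import Data.List.Membership.Propositional.Properties
  using (∈-filter⁺; ∈-filter⁻; ∈-concatMap⁺; ∈-map⁺; ∈-map⁻; ∈-cartesianProduct⁺; ∈-cartesianProduct⁻; ∈-allFin)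
open import Data.List.Membership.Propositional.Properties.WithK using (unique∧set⇒bag)
open import Data.List.Relation.Binary.BagAndSetEquality using (∼bag⇒↭)
open import Data.List.Relation.Binary.Permutation.Propositional using (_↭_)
import Data.List.Relation.Binary.Permutation.Propositional.Properties as ↭
open import Data.List.Relation.Unary.All as All using (All; []; _∷_)
open import Data.List.Relation.Unary.AllPairs using ([]; _∷_)
open import Data.List.Relation.Unary.Any as Any using (here)
open import Data.List.Relation.Unary.Unique.Propositional using (Unique)
import Data.List.Relation.Unary.Unique.Propositional.Properties as Unique
open import Data.Nat as ℕ using (zero; suc; _+_; _*_; _<_; z≤n; s≤s; _≡ᵇ_; _<ᵇ_)
open import Data.Nat.ListAction using (sum)
open import Data.Nat.ListAction.Properties using (sum-++; sum-↭)
open import Data.Nat.Properties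
open import Data.Nat.Tactic.RingSolver using (solve-∀)
open import Data.Product using (_,_; proj₁; proj₂; ∃)
open import Data.Vec as Vec using (Vec)
import Data.Vec.Properties as Vec
open import Function using (_∘_; Equivalence)
open import Function.Bundles using (mk⇔)
open import Relation.Binary.PropositionalEquality using (_≢_; refl; sym; trans; cong; cong₂; subst; module ≡-Reasoning)
open import Relation.Nullary using (contradiction; yes; no)

module ∧ = CommutativeSemigroupProperties (CommutativeMonoid.commutativeSemigroup ∧-commutativeMonoid)

≡ᵇ-refl : ∀ n → (n ≡ᵇ n) ≡ true
≡ᵇ-refl zero = refl
≡ᵇ-refl (suc n) = ≡ᵇ-refl n

<⇒≡ᵇ≡false : ∀ {i n} → i < n → (i ≡ᵇ n) ≡ false
<⇒≡ᵇ≡false {i} {n} i<n with i ≡ᵇ n in eq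
... | false = refl
... | true  = contradiction (≡ᵇ⇒≡ i n (Equivalence.from T-≡ eq)) (<⇒≢ i<n)

≡ᵇ-sym : ∀ x y → (x ≡ᵇ y) ≡ (y ≡ᵇ x)
≡ᵇ-sym zero    zero    = refl
≡ᵇ-sym zero    (suc y) = refl
≡ᵇ-sym (suc x) zero    = refl
≡ᵇ-sym (suc x) (suc y) = ≡ᵇ-sym x y

not-≡ᵇ⇒≢ : ∀ {x y} → not (x ≡ᵇ y) ≡ true → x ≢ y
not-≡ᵇ⇒≢ {x} {y} ne x≡y with x ≡ᵇ y | ≡⇒≡ᵇ x y x≡y
not-≡ᵇ⇒≢ () x≡y | true | _

<⇒<ᵇ≡true : ∀ {m n} → m < n → (m <ᵇ n) ≡ true
<⇒<ᵇ≡true m<n = Equivalence.to T-≡ (<⇒<ᵇ m<n)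

>⇒<ᵇ≡false : ∀ {m n} → n < m → (m <ᵇ n) ≡ false
>⇒<ᵇ≡false {m} {n} n<m with m <ᵇ n in eq
... | false = refl
... | true  = contradiction (<ᵇ⇒< m n (Equivalence.from T-≡ eq)) (<-asym n<m)

<⇒not-≤ᵇ≡false : ∀ {x z} → x ℤ.< z → not (x ℤ.≤ᵇ z) ≡ false
<⇒not-≤ᵇ≡false {x} {z} x<z with x ℤ.≤ᵇ z | ℤ.≤⇒≤ᵇ (ℤ.<⇒≤ x<z)
... | true | _ = refl

>⇒not-≤ᵇ≡true : ∀ {x z} → z ℤ.< x → not (x ℤ.≤ᵇ z) ≡ true
>⇒not-≤ᵇ≡true {x} {z} z<x with x ℤ.≤ᵇ z in eq
... | false = refl
... | true  = contradiction (ℤ.≤ᵇ⇒≤ (Equivalence.from T-≡ eq)) (ℤ.<⇒≱ z<x)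

+-==ℤ-+ : ∀ r m → (+ r ==ℤ + m) ≡ (r ≡ᵇ m)
+-==ℤ-+ zero    zero    = refl
+-==ℤ-+ zero    (suc m) = refl
+-==ℤ-+ (suc r) zero    = refl
+-==ℤ-+ (suc r) (suc m) = trans (cong₂ _∧_ (≤ᵇ-suc r m) (≤ᵇ-suc m r)) (+-==ℤ-+ r m)
  where
  ≤ᵇ-suc : ∀ r m → (suc r ℕ.≤ᵇ suc m) ≡ (r ℕ.≤ᵇ m)
  ≤ᵇ-suc zero    m = refl
  ≤ᵇ-suc (suc r) m = refl

indicator : Bool → ℕ
indicator b = if b then 1 else 0

count : {X : Set} → (X → Bool) → List X → ℕ
count p xs = sum (map (indicator ∘ p) xs)

length-filter-≡true : {X : Set} (p : X → Bool) (xs : List X) →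
  length (filter (λ x → p x Bool.≟ true) xs) ≡ count p xs
length-filter-≡true p [] = refl
length-filter-≡true p (x ∷ xs) with p x
... | true  = cong suc (length-filter-≡true p xs)
... | false = length-filter-≡true p xs

count-const-false : {X : Set} (xs : List X) → count (λ _ → false) xs ≡ 0
count-const-false [] = refl
count-const-false (x ∷ xs) = count-const-false xs

count-cong : {X : Set} {p q : X → Bool} (xs : List X) → (∀ x → p x ≡ q x) → count p xs ≡ count q xs
count-cong xs p≗q = cong sum (map-cong (cong indicator ∘ p≗q) xs)

sum-map-↭ : {X : Set} (f : X → ℕ) {xs ys : List X} → xs ↭ ys → sum (map f xs) ≡ sum (map f ys)
sum-map-↭ f xs↭ys = sum-↭ (↭.map⁺ f xs↭ys)

sum-map-+ : {X : Set} (f g : X → ℕ) (xs : List X) →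
  sum (map (λ x → f x + g x) xs) ≡ sum (map f xs) + sum (map g xs)
sum-map-+ f g [] = refl
sum-map-+ f g (x ∷ xs) = trans (cong (_+_ (f x + g x)) (sum-map-+ f g xs)) (exchange (f x) (g x) _ _)
  where
  exchange : ∀ a b c d → a + b + (c + d) ≡ a + c + (b + d)
  exchange = solve-∀

sum-map-*ˡ : {X : Set} (c : ℕ) (f : X → ℕ) (xs : List X) → sum (map (λ x → c * f x) xs) ≡ c * sum (map f xs)
sum-map-*ˡ c f [] = sym (*-zeroʳ c)
sum-map-*ˡ c f (x ∷ xs) = trans (cong (_+_ (c * f x)) (sum-map-*ˡ c f xs)) (sym (*-distribˡ-+ c (f x) _))

sum-map-cartesianProduct : {X Y : Set} (f : X × Y → ℕ) (xs : List X) (ys : List Y) →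
  sum (map f (cartesianProduct xs ys)) ≡ sum (map (λ x → sum (map (λ y → f (x , y)) ys)) xs)
sum-map-cartesianProduct f [] ys = refl
sum-map-cartesianProduct f (x ∷ xs) ys = begin
    sum (map f (map (x ,_) ys ++ cartesianProduct xs ys))
  ≡⟨ cong sum (map-++ f (map (x ,_) ys) _) ⟩
    sum (map f (map (x ,_) ys) ++ map f (cartesianProduct xs ys))
  ≡⟨ sum-++ (map f (map (x ,_) ys)) _ ⟩
    sum (map f (map (x ,_) ys)) + sum (map f (cartesianProduct xs ys))
  ≡⟨ cong₂ _+_ (cong sum (sym (map-∘ ys))) (sum-map-cartesianProduct f xs ys) ⟩
    sum (map (λ y → f (x , y)) ys) + sum (map (λ x → sum (map (λ y → f (x , y)) ys)) xs) ∎
  where open ≡-Reasoning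

sum-map-linear : {X : Set} (xs : List X) (S U V : X → ℕ) (c₁ c₂ c₃ : ℕ) →
  (∀ x → x ∈ xs → S x + c₁ * U x ≡ c₂ * U x + c₃ * V x) →
  sum (map S xs) + c₁ * sum (map U xs) ≡ c₂ * sum (map U xs) + c₃ * sum (map V xs)
sum-map-linear xs S U V c₁ c₂ c₃ rel = begin
    sum (map S xs) + c₁ * sum (map U xs)
  ≡⟨ cong (_+_ (sum (map S xs))) (sym (sum-map-*ˡ c₁ U xs)) ⟩
    sum (map S xs) + sum (map (λ x → c₁ * U x) xs)
  ≡⟨ sym (sum-map-+ S _ xs) ⟩
    sum (map (λ x → S x + c₁ * U x) xs)
  ≡⟨ cong sum (map-cong-local (All.tabulate (λ {x} → rel x))) ⟩
    sum (map (λ x → c₂ * U x + c₃ * V x) xs)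
  ≡⟨ sum-map-+ _ _ xs ⟩
    sum (map (λ x → c₂ * U x) xs) + sum (map (λ x → c₃ * V x) xs)
  ≡⟨ cong₂ _+_ (sum-map-*ˡ c₂ U xs) (sum-map-*ˡ c₃ V xs) ⟩
    c₂ * sum (map U xs) + c₃ * sum (map V xs) ∎
  where open ≡-Reasoning

sum-map-allFin-suc : {m : ℕ} (f : Fin (suc m) → ℕ) →
  sum (map f (allFin (suc m))) ≡ f fzero + sum (map (f ∘ fsuc) (allFin m))
sum-map-allFin-suc f = cong (λ s → f fzero + sum s) (trans (map-tabulate fsuc f) (sym (map-tabulate (λ i → i) (f ∘ fsuc))))

count-allFin-const : (a : ℕ) (p : Fin a → Bool) (k : ℕ) → (∀ c → indicator (p c) ≡ k) → count p (allFin a) ≡ a * k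
count-allFin-const zero p k const = refl
count-allFin-const (suc a) p k const = trans (sum-map-allFin-suc (indicator ∘ p))
  (cong₂ _+_ (const fzero) (count-allFin-const a (p ∘ fsuc) k (const ∘ fsuc)))

-- Stated with ∣ L ∣ * indicator b₀ moved to the left so that no subtraction occurs.
count-allFin-lookup-if : (a : ℕ) (L : Subset a) (b₁ b₀ : Bool) →
  count (λ c → if Vec.lookup L c then b₁ else b₀) (allFin a) + ∣ L ∣ * indicator b₀
    ≡ ∣ L ∣ * indicator b₁ + a * indicator b₀
count-allFin-lookup-if zero Vec.[] b₁ b₀ = refl
count-allFin-lookup-if (suc a) (inL Vec.∷ L) b₁ b₀ = begin
    count (λ c → if Vec.lookup (inL Vec.∷ L) c then b₁ else b₀) (allFin (suc a)) + ∣ inL Vec.∷ L ∣ * x₀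
  ≡⟨ cong (_+ ∣ inL Vec.∷ L ∣ * x₀)
       (sum-map-allFin-suc (λ c → indicator (if Vec.lookup (inL Vec.∷ L) c then b₁ else b₀))) ⟩
    indicator (if inL then b₁ else b₀) + C + ∣ inL Vec.∷ L ∣ * x₀
  ≡⟨ step inL ⟩
    ∣ inL Vec.∷ L ∣ * x₁ + suc a * x₀ ∎
  where
  open ≡-Reasoning
  x₁ = indicator b₁
  x₀ = indicator b₀
  C = count (λ c → if Vec.lookup L c then b₁ else b₀) (allFin a)
  IH : C + ∣ L ∣ * x₀ ≡ ∣ L ∣ * x₁ + a * x₀
  IH = count-allFin-lookup-if a L b₁ b₀
  step : ∀ inL → indicator (if inL then b₁ else b₀) + C + ∣ inL Vec.∷ L ∣ * x₀ ≡ ∣ inL Vec.∷ L ∣ * x₁ + suc a * x₀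
  step true = trans (regroup x₁ x₀ C ∣ L ∣) (trans (cong (_+_ (x₁ + x₀)) IH) (sym (regroup′ x₁ x₀ ∣ L ∣ a)))
    where
    regroup : ∀ x₁ x₀ C l → x₁ + C + suc l * x₀ ≡ x₁ + x₀ + (C + l * x₀)
    regroup = solve-∀
    regroup′ : ∀ x₁ x₀ l a → suc l * x₁ + suc a * x₀ ≡ x₁ + x₀ + (l * x₁ + a * x₀)
    regroup′ = solve-∀
  step false = trans (+-assoc x₀ C _) (trans (cong (_+_ x₀) IH) (sym (regroup x₁ x₀ ∣ L ∣ a)))
    where
    regroup : ∀ x₁ x₀ l a → l * x₁ + suc a * x₀ ≡ x₀ + (l * x₁ + a * x₀)
    regroup = solve-∀

sum-map-toℕ-allFin : (m : ℕ) (f : ℕ → ℕ) → sum (map (f ∘ toℕ) (allFin m)) ≡ sum (applyUpTo f m)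
sum-map-toℕ-allFin zero f = refl
sum-map-toℕ-allFin (suc m) f = trans (sum-map-allFin-suc {m} (f ∘ toℕ)) (cong (_+_ (f 0)) (sum-map-toℕ-allFin m (f ∘ suc)))

sum-applyUpTo-suc : (f : ℕ → ℕ) (n : ℕ) → sum (applyUpTo f (suc n)) ≡ sum (applyUpTo f n) + f n
sum-applyUpTo-suc f n = trans (cong sum (sym (applyUpTo-∷ʳ f n)))
  (trans (sum-++ (applyUpTo f n) _) (cong (_+_ (sum (applyUpTo f n))) (+-identityʳ (f n))))

sum-applyUpTo-const : (n k : ℕ) → sum (applyUpTo (λ _ → k) n) ≡ n * k
sum-applyUpTo-const zero    k = refl
sum-applyUpTo-const (suc n) k = cong (_+_ k) (sum-applyUpTo-const n k)

sum-applyUpTo-*ˡ : (n c : ℕ) (f : ℕ → ℕ) → sum (applyUpTo (λ i → c * f i) n) ≡ c * sum (applyUpTo f n)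
sum-applyUpTo-*ˡ zero    c f = sym (*-zeroʳ c)
sum-applyUpTo-*ˡ (suc n) c f = trans (cong (_+_ (c * f 0)) (sum-applyUpTo-*ˡ n c (f ∘ suc))) (sym (*-distribˡ-+ c (f 0) _))

applyUpTo-cong-< : {X : Set} {f h : ℕ → X} (n : ℕ) → (∀ i → i < n → f i ≡ h i) → applyUpTo f n ≡ applyUpTo h n
applyUpTo-cong-< zero f≗h = refl
applyUpTo-cong-< (suc n) f≗h = cong₂ _∷_ (f≗h 0 (s≤s z≤n)) (applyUpTo-cong-< n (λ i i<n → f≗h (suc i) (s≤s i<n)))

sum-allFin-last : (n : ℕ) (f : ℕ → ℕ) (last : ℕ) →
  sum (map (λ p → if toℕ p ≡ᵇ n then last else f (toℕ p)) (allFin (suc n))) ≡ sum (applyUpTo f n) + last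
sum-allFin-last n f last = begin
    sum (map (H ∘ toℕ) (allFin (suc n)))
  ≡⟨ sum-map-toℕ-allFin (suc n) H ⟩
    sum (applyUpTo H (suc n))
  ≡⟨ sum-applyUpTo-suc H n ⟩
    sum (applyUpTo H n) + H n
  ≡⟨ cong₂ _+_ (cong sum (applyUpTo-cong-< n (λ i i<n → cong (if_then last else f i) (<⇒≡ᵇ≡false i<n))))
               (cong (if_then last else f n) (≡ᵇ-refl n)) ⟩
    sum (applyUpTo f n) + last ∎
  where
  open ≡-Reasoning
  H : ℕ → ℕ
  H i = if i ≡ᵇ n then last else f i

insertAtℕ : {X : Set} → ℕ → X → List X → List X
insertAtℕ zero    y ys       = y ∷ ys
insertAtℕ (suc i) y []       = y ∷ []
insertAtℕ (suc i) y (x ∷ xs) = x ∷ insertAtℕ i y xs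

map-insertAtℕ : {X Y : Set} (f : X → Y) (i : ℕ) (y : X) (ys : List X) →
  map f (insertAtℕ i y ys) ≡ insertAtℕ i (f y) (map f ys)
map-insertAtℕ f zero    y ys       = refl
map-insertAtℕ f (suc i) y []       = refl
map-insertAtℕ f (suc i) y (x ∷ xs) = cong (f x ∷_) (map-insertAtℕ f i y xs)

allB-insertAtℕ : {X : Set} (p : X → Bool) (i : ℕ) (y : X) (ys : List X) →
  allB p (insertAtℕ i y ys) ≡ p y ∧ allB p ys
allB-insertAtℕ p zero    y ys       = refl
allB-insertAtℕ p (suc i) y []       = refl
allB-insertAtℕ p (suc i) y (x ∷ xs) =
  trans (cong (p x ∧_) (allB-insertAtℕ p i y xs)) (∧.x∙yz≈y∙xz (p x) (p y) _)

notElem-insertAtℕ : (x i y : ℕ) (ys : List ℕ) → notElem x (insertAtℕ i y ys) ≡ not (x ≡ᵇ y) ∧ notElem x ys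
notElem-insertAtℕ x zero    y ys       = refl
notElem-insertAtℕ x (suc i) y []       = refl
notElem-insertAtℕ x (suc i) y (z ∷ zs) =
  trans (cong (not (x ≡ᵇ z) ∧_) (notElem-insertAtℕ x i y zs)) (∧.x∙yz≈y∙xz (not (x ≡ᵇ z)) (not (x ≡ᵇ y)) (notElem x zs))

distinct-insertAtℕ : (i y : ℕ) (ys : List ℕ) → distinct (insertAtℕ i y ys) ≡ notElem y ys ∧ distinct ys
distinct-insertAtℕ zero    y ys       = refl
distinct-insertAtℕ (suc i) y []       = refl
distinct-insertAtℕ (suc i) y (x ∷ xs) = begin
    notElem x (insertAtℕ i y xs) ∧ distinct (insertAtℕ i y xs)
  ≡⟨ cong₂ _∧_ (notElem-insertAtℕ x i y xs) (distinct-insertAtℕ i y xs) ⟩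
    (not (x ≡ᵇ y) ∧ notElem x xs) ∧ (notElem y xs ∧ distinct xs)
  ≡⟨ ∧.interchange (not (x ≡ᵇ y)) (notElem x xs) (notElem y xs) (distinct xs) ⟩
    (not (x ≡ᵇ y) ∧ notElem y xs) ∧ (notElem x xs ∧ distinct xs)
  ≡⟨ cong (λ b → (not b ∧ notElem y xs) ∧ (notElem x xs ∧ distinct xs)) (≡ᵇ-sym x y) ⟩
    (not (y ≡ᵇ x) ∧ notElem y xs) ∧ (notElem x xs ∧ distinct xs) ∎
  where open ≡-Reasoning

rlminL'-insertAtℕ-max : {a : ℕ} (L : Subset a) (N : ℕ) (c : Fin a) (i : ℕ) (xs : List (ℕ × Fin a)) →
  All (λ e → proj₁ e < N) xs → i ≤ length xs →
  rlminL' L (insertAtℕ i (N , c) xs) ≡ rlminL' L xs + (if i ≡ᵇ length xs then indicator (Vec.lookup L c) else 0)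
rlminL'-insertAtℕ-max L N c zero [] [] _ = +-identityʳ _
rlminL'-insertAtℕ-max L N c zero ((j , t) ∷ xs) (j<N ∷ _) _ rewrite >⇒<ᵇ≡false j<N = sym (+-identityʳ _)
rlminL'-insertAtℕ-max L N c (suc i) ((j , t) ∷ xs) (j<N ∷ xs<N) (s≤s i≤) = begin
    indicator (allB j<_ (insertAtℕ i (N , c) xs) ∧ Vec.lookup L t) + rlminL' L (insertAtℕ i (N , c) xs)
  ≡⟨ cong₂ (λ b r → indicator (b ∧ Vec.lookup L t) + r)
       (trans (allB-insertAtℕ j<_ i (N , c) xs) (cong (_∧ allB j<_ xs) (<⇒<ᵇ≡true j<N)))
       (rlminL'-insertAtℕ-max L N c i xs xs<N i≤) ⟩
    indicator (allB j<_ xs ∧ Vec.lookup L t) + (rlminL' L xs + new)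
  ≡⟨ sym (+-assoc (indicator (allB j<_ xs ∧ Vec.lookup L t)) _ new) ⟩
    rlminL' L ((j , t) ∷ xs) + new ∎
  where
  open ≡-Reasoning
  j<_ : ℕ × Fin _ → Bool
  j<_ e = j <ᵇ proj₁ e
  new = if i ≡ᵇ length xs then indicator (Vec.lookup L c) else 0

-- Inserting at position i separates the two entries compared by descentAt i.
descentAt : ℕ → List ℤ → ℕ
descentAt zero    (x ∷ y ∷ _) = indicator (not (x ℤ.≤ᵇ y))
descentAt zero    _           = 0
descentAt (suc i) []          = 0
descentAt (suc i) (_ ∷ ys)    = descentAt i ys

descentAt≤1 : ∀ i ys → descentAt i ys ≤ 1
descentAt≤1 zero    (x ∷ y ∷ _) with not (x ℤ.≤ᵇ y)
... | true  = ≤-refl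
... | false = z≤n
descentAt≤1 zero    []          = z≤n
descentAt≤1 zero    (_ ∷ [])    = z≤n
descentAt≤1 (suc i) []          = z≤n
descentAt≤1 (suc i) (_ ∷ ys)    = descentAt≤1 i ys

descentAt-length : (y : ℤ) (ks : List ℤ) → descentAt (length ks) (y ∷ ks) ≡ 0
descentAt-length y []       = refl
descentAt-length y (k ∷ ks) = descentAt-length k ks

sum-descentAt : (y : ℤ) (ks : List ℤ) → sum (applyUpTo (λ i → descentAt i (y ∷ ks)) (length ks)) ≡ descents (y ∷ ks)
sum-descentAt y []       = refl
sum-descentAt y (k ∷ ks) = cong (_+_ (descentAt 0 (y ∷ k ∷ ks))) (sum-descentAt k ks)

descents-insertAtℕ-max : (z y : ℤ) (i : ℕ) (ks : List ℤ) → All (ℤ._< z) (y ∷ ks) → i ≤ length ks →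
  descents (y ∷ insertAtℕ i z ks) + descentAt i (y ∷ ks) ≡ descents (y ∷ ks) + (if i ≡ᵇ length ks then 0 else 1)
descents-insertAtℕ-max z y zero    []       (y<z ∷ [])         _       rewrite <⇒not-≤ᵇ≡false y<z = refl
descents-insertAtℕ-max z y zero    (k ∷ ks) (y<z ∷ k<z ∷ _)    _       rewrite <⇒not-≤ᵇ≡false y<z | >⇒not-≤ᵇ≡true k<z =
  rearrange (descents (k ∷ ks)) (descentAt 0 (y ∷ k ∷ ks))
  where
  rearrange : ∀ d δ → 0 + (1 + d) + δ ≡ δ + d + 1
  rearrange = solve-∀
descents-insertAtℕ-max z y (suc i) (k ∷ ks) (y<z ∷ ks<z)       (s≤s i≤) =
  trans (+-assoc (descentAt 0 (y ∷ k ∷ ks)) _ _)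
    (trans (cong (_+_ (descentAt 0 (y ∷ k ∷ ks))) (descents-insertAtℕ-max z k i ks ks<z i≤))
      (sym (+-assoc (descentAt 0 (y ∷ k ∷ ks)) _ _)))

descents-insertAtℕ-min : (z y : ℤ) (i : ℕ) (ks : List ℤ) → All (z ℤ.<_) (y ∷ ks) → i ≤ length ks →
  descents (y ∷ insertAtℕ i z ks) + descentAt i (y ∷ ks) ≡ descents (y ∷ ks) + 1
descents-insertAtℕ-min z y zero    []       (z<y ∷ [])         _       rewrite >⇒not-≤ᵇ≡true z<y = refl
descents-insertAtℕ-min z y zero    (k ∷ ks) (z<y ∷ z<k ∷ _)    _       rewrite >⇒not-≤ᵇ≡true z<y | <⇒not-≤ᵇ≡false z<k =
  rearrange (descents (k ∷ ks)) (descentAt 0 (y ∷ k ∷ ks))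
  where
  rearrange : ∀ d δ → 1 + (0 + d) + δ ≡ δ + d + 1
  rearrange = solve-∀
descents-insertAtℕ-min z y (suc i) (k ∷ ks) (z<y ∷ z<ks)       (s≤s i≤) =
  trans (+-assoc (descentAt 0 (y ∷ k ∷ ks)) _ _)
    (trans (cong (_+_ (descentAt 0 (y ∷ k ∷ ks))) (descents-insertAtℕ-min z k i ks z<ks i≤))
      (sym (+-assoc (descentAt 0 (y ∷ k ∷ ks)) _ _)))

concatMap-map≡cartesianProductWith : {X Y Z : Set} (f : X → Y → Z) (xs : List X) (ys : List Y) →
  concatMap (λ x → map (f x) ys) xs ≡ cartesianProductWith f xs ys
concatMap-map≡cartesianProductWith f []       ys = refl
concatMap-map≡cartesianProductWith f (x ∷ xs) ys = cong (map (f x) ys ++_) (concatMap-map≡cartesianProductWith f xs ys)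

allVecs-complete : {X : Set} (xs : List X) → (∀ x → x ∈ xs) → {m : ℕ} (v : Vec X m) → v ∈ allVecs xs m
allVecs-complete xs complete Vec.[]       = here refl
allVecs-complete xs complete (x Vec.∷ v) =
  ∈-concatMap⁺ (λ y → map (y Vec.∷_) (allVecs xs _))
    (Any.map (λ { refl → ∈-map⁺ (x Vec.∷_) (allVecs-complete xs complete v) }) (complete x))

allVecs-unique : {X : Set} (xs : List X) → Unique xs → (m : ℕ) → Unique (allVecs xs m)
allVecs-unique xs unique zero    = [] ∷ []
allVecs-unique xs unique (suc m) = subst Unique (sym (concatMap-map≡cartesianProductWith Vec._∷_ xs (allVecs xs m)))
  (Unique.cartesianProductWith⁺ Vec._∷_ Vec.∷-injective unique (allVecs-unique xs unique m))

module _ {a : ℕ} where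

  ∈-colPerms⁺ : {n : ℕ} (w : Vec (Entry a n) n) → isColPerm w ≡ true → w ∈ colPerms a n
  ∈-colPerms⁺ w isPerm = ∈-filter⁺ (λ w → isColPerm w Bool.≟ true)
    (allVecs-complete _ (λ (j , c) → ∈-cartesianProduct⁺ (∈-allFin j) (∈-allFin c)) w) isPerm

  ∈-colPerms⁻ : {n : ℕ} {w : Vec (Entry a n) n} → w ∈ colPerms a n → isColPerm w ≡ true
  ∈-colPerms⁻ {n} w∈ = proj₂ (∈-filter⁻ (λ w → isColPerm w Bool.≟ true)
    {xs = allVecs (cartesianProduct (allFin n) (allFin a)) n} w∈)

  colPerms-unique : (n : ℕ) → Unique (colPerms a n)
  colPerms-unique n = Unique.filter⁺ (λ w → isColPerm w Bool.≟ true)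
    (allVecs-unique _ (Unique.cartesianProduct⁺ (Unique.allFin⁺ n) (Unique.allFin⁺ a)) n)

  -- absCol for words of any length; absCol w is definitionally absEntries w.
  absEntries : {n m : ℕ} → Vec (Entry a n) m → List (ℕ × Fin a)
  absEntries w = map (λ e → suc (toℕ (proj₁ e)) , proj₂ e) (Vec.toList w)

  absValues : {n m : ℕ} → Vec (Entry a n) m → List ℕ
  absValues w = map proj₁ (absEntries w)

  length-absEntries : {n m : ℕ} (w : Vec (Entry a n) m) → length (absEntries w) ≡ m
  length-absEntries Vec.[]      = refl
  length-absEntries (_ Vec.∷ w) = cong suc (length-absEntries w)

  absEntries-bounded : {n m : ℕ} (w : Vec (Entry a n) m) → All (λ e → proj₁ e < suc n) (absEntries w)
  absEntries-bounded Vec.[]            = []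
  absEntries-bounded ((j , c) Vec.∷ w) = s≤s (toℕ<n j) ∷ absEntries-bounded w

  absEntries-insertAt : {n m : ℕ} (w : Vec (Entry a n) m) (p : Fin (suc m)) (e : Entry a n) →
    absEntries (Vec.insertAt w p e) ≡ insertAtℕ (toℕ p) (suc (toℕ (proj₁ e)) , proj₂ e) (absEntries w)
  absEntries-insertAt w           fzero    e = refl
  absEntries-insertAt (x Vec.∷ w) (fsuc p) e = cong (_ ∷_) (absEntries-insertAt w p e)

  liftEntry : {n : ℕ} → Entry a n → Entry a (suc n)
  liftEntry (j , c) = inject₁ j , c

  liftEntry-injective : {n : ℕ} {e e′ : Entry a n} → liftEntry e ≡ liftEntry e′ → e ≡ e′
  liftEntry-injective {e = j , c} {j′ , c′} eq = cong₂ _,_ (inject₁-injective (cong proj₁ eq)) (cong proj₂ eq)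

  absEntries-map-liftEntry : {n m : ℕ} (w : Vec (Entry a n) m) → absEntries (Vec.map liftEntry w) ≡ absEntries w
  absEntries-map-liftEntry Vec.[]            = refl
  absEntries-map-liftEntry ((j , c) Vec.∷ w) = cong₂ (λ x y → (suc x , c) ∷ y) (toℕ-inject₁ j) (absEntries-map-liftEntry w)

  -- fromℕ n is the entry of absolute value n + 1.
  insertMax : {n : ℕ} → Vec (Entry a n) n × Fin (suc n) × Fin a → Vec (Entry a (suc n)) (suc n)
  insertMax {n} (v , p , c) = Vec.insertAt (Vec.map liftEntry v) p (fromℕ n , c)

  absCol-insertMax : {n : ℕ} (v : Vec (Entry a n) n) (p : Fin (suc n)) (c : Fin a) →
    absCol (insertMax (v , p , c)) ≡ insertAtℕ (toℕ p) (suc n , c) (absCol v)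
  absCol-insertMax {n} v p c = trans (absEntries-insertAt (Vec.map liftEntry v) p (fromℕ n , c))
    (cong₂ (λ x y → insertAtℕ (toℕ p) (suc x , c) y) (toℕ-fromℕ n) (absEntries-map-liftEntry v))

  notElem-bounded : (N : ℕ) (xs : List (ℕ × Fin a)) → All (λ e → proj₁ e < N) xs → notElem N (map proj₁ xs) ≡ true
  notElem-bounded N []            []            = refl
  notElem-bounded N ((y , c) ∷ xs) (y<N ∷ xs<N) with N ≡ᵇ y in eq
  ... | true  = contradiction (≡ᵇ⇒≡ N y (Equivalence.from T-≡ eq)) (>⇒≢ y<N)
  ... | false = notElem-bounded N xs xs<N

  insertMax-isColPerm : {n : ℕ} (v : Vec (Entry a n) n) (p : Fin (suc n)) (c : Fin a) →
    isColPerm v ≡ true → isColPerm (insertMax (v , p , c)) ≡ true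
  insertMax-isColPerm {n} v p c isPerm = begin
      distinct (map proj₁ (absCol (insertMax (v , p , c))))
    ≡⟨ cong (distinct ∘ map proj₁) (absCol-insertMax v p c) ⟩
      distinct (map proj₁ (insertAtℕ (toℕ p) (suc n , c) (absCol v)))
    ≡⟨ cong distinct (map-insertAtℕ proj₁ (toℕ p) (suc n , c) (absCol v)) ⟩
      distinct (insertAtℕ (toℕ p) (suc n) (absValues v))
    ≡⟨ distinct-insertAtℕ (toℕ p) (suc n) _ ⟩
      notElem (suc n) (absValues v) ∧ distinct (absValues v)
    ≡⟨ cong₂ _∧_ (notElem-bounded (suc n) (absCol v) (absEntries-bounded v)) isPerm ⟩
      true ∎
    where open ≡-Reasoning

  map-liftEntry-injective : {n m : ℕ} (v v′ : Vec (Entry a n) m) → Vec.map liftEntry v ≡ Vec.map liftEntry v′ → v ≡ v′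
  map-liftEntry-injective Vec.[]      Vec.[]        _  = refl
  map-liftEntry-injective (x Vec.∷ v) (y Vec.∷ v′) eq =
    cong₂ Vec._∷_ (liftEntry-injective (Vec.∷-injectiveˡ eq)) (map-liftEntry-injective v v′ (Vec.∷-injectiveʳ eq))

  -- The inserted entry is the only one with absolute value n + 1, which pins down p, then c and v.
  insertMax-injective : {n : ℕ} {t t′ : Vec (Entry a n) n × Fin (suc n) × Fin a} → insertMax t ≡ insertMax t′ → t ≡ t′
  insertMax-injective {n} {v , p , c} {v′ , p′ , c′} eq with p Fin.≟ p′
  ... | yes refl = cong₂ _,_ (map-liftEntry-injective v v′ lifted-eq) (cong (p ,_) (cong proj₂ inserted-eq))
    where
    inserted-eq : (fromℕ n , c) ≡ (fromℕ n , c′)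
    inserted-eq = trans (sym (Vec.insertAt-lookup (Vec.map liftEntry v) p _))
      (trans (cong (λ w → Vec.lookup w p) eq) (Vec.insertAt-lookup (Vec.map liftEntry v′) p _))
    lifted-eq : Vec.map liftEntry v ≡ Vec.map liftEntry v′
    lifted-eq = trans (sym (Vec.removeAt-insertAt (Vec.map liftEntry v) p _))
      (trans (cong (λ w → Vec.removeAt w p) eq) (Vec.removeAt-insertAt (Vec.map liftEntry v′) p _))
  ... | no p≢p′ = contradiction (cong proj₁ inserted-eq) fromℕ≢inject₁
    where
    p′≢p : p′ ≢ p
    p′≢p = p≢p′ ∘ sym
    k : Fin n
    k = punchOut p′≢p
    inserted-eq : (fromℕ n , c) ≡ liftEntry (Vec.lookup v′ k)
    inserted-eq = begin
        (fromℕ n , c)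
      ≡⟨ sym (Vec.insertAt-lookup (Vec.map liftEntry v) p _) ⟩
        Vec.lookup (insertMax (v , p , c)) p
      ≡⟨ cong (λ w → Vec.lookup w p) eq ⟩
        Vec.lookup (insertMax (v′ , p′ , c′)) p
      ≡⟨ cong (Vec.lookup (insertMax (v′ , p′ , c′))) (sym (punchIn-punchOut p′≢p)) ⟩
        Vec.lookup (insertMax (v′ , p′ , c′)) (punchIn p′ k)
      ≡⟨ Vec.insertAt-punchIn (Vec.map liftEntry v′) p′ _ k ⟩
        Vec.lookup (Vec.map liftEntry v′) k
      ≡⟨ Vec.lookup-map k liftEntry v′ ⟩
        liftEntry (Vec.lookup v′ k) ∎
      where open ≡-Reasoning

  notElem-absValues : {k m : ℕ} (y : ℕ) (w : Vec (Entry a k) m) → notElem y (absValues w) ≡ true →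
    ∀ j → y ≢ suc (toℕ (proj₁ (Vec.lookup w j)))
  notElem-absValues y (x Vec.∷ w) ∉ fzero    = not-≡ᵇ⇒≢ (∧-conicalˡ _ _ ∉)
  notElem-absValues y (x Vec.∷ w) ∉ (fsuc j) = notElem-absValues y w (∧-conicalʳ _ _ ∉) j

  distinct-absValues⇒injective : {k m : ℕ} (w : Vec (Entry a k) m) → distinct (absValues w) ≡ true → (i j : Fin m) →
    toℕ (proj₁ (Vec.lookup w i)) ≡ toℕ (proj₁ (Vec.lookup w j)) → i ≡ j
  distinct-absValues⇒injective (x Vec.∷ w) dist fzero    fzero    eq = refl
  distinct-absValues⇒injective (x Vec.∷ w) dist fzero    (fsuc j) eq =
    contradiction (cong suc eq) (notElem-absValues _ w (∧-conicalˡ _ _ dist) j)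
  distinct-absValues⇒injective (x Vec.∷ w) dist (fsuc i) fzero    eq =
    contradiction (cong suc (sym eq)) (notElem-absValues _ w (∧-conicalˡ _ _ dist) i)
  distinct-absValues⇒injective (x Vec.∷ w) dist (fsuc i) (fsuc j) eq =
    cong fsuc (distinct-absValues⇒injective w (∧-conicalʳ _ _ dist) i j eq)

  -- By the pigeonhole principle the absolute values of a colored permutation include its size.
  colPerm-has-max : {n : ℕ} (z : Vec (Entry a (suc n)) (suc n)) → isColPerm z ≡ true →
    ∃ λ p → toℕ (proj₁ (Vec.lookup z p)) ≡ n
  colPerm-has-max {n} z isPerm with any? (λ p → toℕ (proj₁ (Vec.lookup z p)) ℕ.≟ n)
  ... | yes found = found
  ... | no none   with pigeonhole ≤-refl (λ p → lower₁ (proj₁ (Vec.lookup z p)) (λ eq → none (p , sym eq)))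
  ...   | i , j , i<j , same = contradiction
            (distinct-absValues⇒injective z isPerm i j (trans (sym (toℕ-lower₁ _ _)) (trans (cong toℕ same) (toℕ-lower₁ _ _))))
            (Fin.<⇒≢ i<j)

  lowerEntries : {n m : ℕ} (w : Vec (Entry a (suc n)) m) → notElem (suc n) (absValues w) ≡ true → Vec (Entry a n) m
  lowerEntries Vec.[]                  _ = Vec.[]
  lowerEntries {n} ((j , c) Vec.∷ w) ∉ =
    (lower₁ j (not-≡ᵇ⇒≢ (∧-conicalˡ _ _ ∉)) , c) Vec.∷ lowerEntries w (∧-conicalʳ (not (n ≡ᵇ toℕ j)) _ ∉)

  map-liftEntry-lowerEntries : {n m : ℕ} (w : Vec (Entry a (suc n)) m) (∉ : notElem (suc n) (absValues w) ≡ true) →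
    Vec.map liftEntry (lowerEntries w ∉) ≡ w
  map-liftEntry-lowerEntries Vec.[]                  _ = refl
  map-liftEntry-lowerEntries {n} ((j , c) Vec.∷ w) ∉ = cong₂ (λ x y → (x , c) Vec.∷ y) (inject₁-lower₁ j _)
    (map-liftEntry-lowerEntries w (∧-conicalʳ (not (n ≡ᵇ toℕ j)) _ ∉))

  absValues-lowerEntries : {n m : ℕ} (w : Vec (Entry a (suc n)) m) (∉ : notElem (suc n) (absValues w) ≡ true) →
    absValues (lowerEntries w ∉) ≡ absValues w
  absValues-lowerEntries Vec.[]                  _ = refl
  absValues-lowerEntries {n} ((j , c) Vec.∷ w) ∉ = cong₂ (λ x y → suc x ∷ y) (toℕ-lower₁ j _)
    (absValues-lowerEntries w (∧-conicalʳ (not (n ≡ᵇ toℕ j)) _ ∉))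

  insertionData : (n : ℕ) → List (Vec (Entry a n) n × Fin (suc n) × Fin a)
  insertionData n = cartesianProduct (colPerms a n) (cartesianProduct (allFin (suc n)) (allFin a))

  -- Removing the entry of absolute value n + 1 inverts insertMax.
  insertMax-surjective : {n : ℕ} (z : Vec (Entry a (suc n)) (suc n)) → isColPerm z ≡ true →
    ∃ λ t → t ∈ insertionData n × z ≡ insertMax t
  insertMax-surjective {n} z isPerm =
    (v , p , c) , ∈-cartesianProduct⁺ (∈-colPerms⁺ v v-isPerm) (∈-cartesianProduct⁺ (∈-allFin p) (∈-allFin c)) , z≡
    where
    p = proj₁ (colPerm-has-max z isPerm)
    e = Vec.lookup z p
    c = proj₂ e
    r = Vec.removeAt z p
    z≡insert : Vec.insertAt r p e ≡ z
    z≡insert = Vec.insertAt-removeAt z p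
    values-z : absValues z ≡ insertAtℕ (toℕ p) (suc n) (absValues r)
    values-z = begin
        absValues z
      ≡⟨ cong absValues (sym z≡insert) ⟩
        map proj₁ (absEntries (Vec.insertAt r p e))
      ≡⟨ cong (map proj₁) (absEntries-insertAt r p e) ⟩
        map proj₁ (insertAtℕ (toℕ p) (suc (toℕ (proj₁ e)) , c) (absEntries r))
      ≡⟨ map-insertAtℕ proj₁ (toℕ p) _ (absEntries r) ⟩
        insertAtℕ (toℕ p) (suc (toℕ (proj₁ e))) (absValues r)
      ≡⟨ cong (λ x → insertAtℕ (toℕ p) (suc x) (absValues r)) (proj₂ (colPerm-has-max z isPerm)) ⟩
        insertAtℕ (toℕ p) (suc n) (absValues r) ∎
      where open ≡-Reasoning
    r-ok : notElem (suc n) (absValues r) ≡ true × distinct (absValues r) ≡ true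
    r-ok = ∧-conicalˡ _ _ r-valid , ∧-conicalʳ _ _ r-valid
      where
      r-valid = trans (sym (distinct-insertAtℕ (toℕ p) (suc n) (absValues r))) (trans (cong distinct (sym values-z)) isPerm)
    v = lowerEntries r (proj₁ r-ok)
    v-isPerm : isColPerm v ≡ true
    v-isPerm = trans (cong distinct (absValues-lowerEntries r (proj₁ r-ok))) (proj₂ r-ok)
    e≡ : e ≡ (fromℕ n , c)
    e≡ = cong (_, c) (toℕ-injective (trans (proj₂ (colPerm-has-max z isPerm)) (sym (toℕ-fromℕ n))))
    z≡ : z ≡ insertMax (v , p , c)
    z≡ = trans (sym z≡insert) (cong₂ (λ x y → Vec.insertAt x p y) (sym (map-liftEntry-lowerEntries r (proj₁ r-ok))) e≡)

  colPerms-suc-↭ : (n : ℕ) → colPerms a (suc n) ↭ map insertMax (insertionData n)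
  colPerms-suc-↭ n = ∼bag⇒↭ (unique∧set⇒bag (colPerms-unique (suc n))
    (Unique.map⁺ insertMax-injective
      (Unique.cartesianProduct⁺ (colPerms-unique n) (Unique.cartesianProduct⁺ (Unique.allFin⁺ (suc n)) (Unique.allFin⁺ a))))
    (mk⇔ to from))
    where
    to : ∀ {z} → z ∈ colPerms a (suc n) → z ∈ map insertMax (insertionData n)
    to {z} z∈ with insertMax-surjective z (∈-colPerms⁻ z∈)
    ... | t , t∈ , refl = ∈-map⁺ insertMax t∈
    from : ∀ {z} → z ∈ map insertMax (insertionData n) → z ∈ colPerms a (suc n)
    from z∈ with ∈-map⁻ insertMax z∈
    ... | (v , p , c) , t∈ , refl =
      ∈-colPerms⁺ _ (insertMax-isColPerm v p c (∈-colPerms⁻ (proj₁ (∈-cartesianProduct⁻ (colPerms a n) _ t∈))))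

  countInsertions : {n : ℕ} → (Vec (Entry a (suc n)) (suc n) → Bool) → Vec (Entry a n) n → ℕ
  countInsertions {n} b v = sum (map (λ p → count (λ c → b (insertMax (v , p , c))) (allFin a)) (allFin (suc n)))

  count-colPerms-suc : (n : ℕ) (b : Vec (Entry a (suc n)) (suc n) → Bool) →
    count b (colPerms a (suc n)) ≡
      sum (map (countInsertions b) (colPerms a n))
  count-colPerms-suc n b = begin
      count b (colPerms a (suc n))
    ≡⟨ sum-map-↭ (indicator ∘ b) (colPerms-suc-↭ n) ⟩
      sum (map (indicator ∘ b) (map insertMax (insertionData n)))
    ≡⟨ cong sum (sym (map-∘ (insertionData n))) ⟩
      sum (map (indicator ∘ b ∘ insertMax) (insertionData n))
    ≡⟨ sum-map-cartesianProduct _ (colPerms a n) _ ⟩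
      sum (map (λ v → sum (map (λ pc → indicator (b (insertMax (v , pc)))) (cartesianProduct (allFin (suc n)) (allFin a)))) (colPerms a n))
    ≡⟨ cong sum (map-cong (λ v → sum-map-cartesianProduct _ (allFin (suc n)) (allFin a)) (colPerms a n)) ⟩
      sum (map (countInsertions b) (colPerms a n)) ∎
    where open ≡-Reasoning

module _ {a : ℕ} (L : Subset a) where

  keys : {n : ℕ} → Vec (Entry a n) n → List ℤ
  keys v = 0ℤ ∷ map (keyL L) (absCol v)

  length-keys : {n : ℕ} (v : Vec (Entry a n) n) → length (map (keyL L) (absCol v)) ≡ n
  length-keys v = trans (length-map (keyL L) (absCol v)) (length-absEntries v)

  keys-below : {n m : ℕ} (w : Vec (Entry a n) m) → All (ℤ._< + suc n) (0ℤ ∷ map (keyL L) (absEntries w))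
  keys-below {n} w = ℤ.+<+ (s≤s z≤n) ∷ go w
    where
    go : {m : ℕ} (w : Vec (Entry a n) m) → All (ℤ._< + suc n) (map (keyL L) (absEntries w))
    go Vec.[]            = []
    go ((j , c) Vec.∷ w) with Vec.lookup L c
    ... | true  = ℤ.-<+ ∷ go w
    ... | false = ℤ.+<+ (s≤s (toℕ<n j)) ∷ go w

  keys-above : {n m : ℕ} (w : Vec (Entry a n) m) → All (-[1+ n ] ℤ.<_) (0ℤ ∷ map (keyL L) (absEntries w))
  keys-above {n} w = ℤ.-<+ ∷ go w
    where
    go : {m : ℕ} (w : Vec (Entry a n) m) → All (-[1+ n ] ℤ.<_) (map (keyL L) (absEntries w))
    go Vec.[]            = []
    go ((j , c) Vec.∷ w) with Vec.lookup L c
    ... | true  = ℤ.-<- (toℕ<n j) ∷ go w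
    ... | false = ℤ.-<+ ∷ go w

  rlminL-insertMax : {n : ℕ} (v : Vec (Entry a n) n) (p : Fin (suc n)) (c : Fin a) →
    rlminL L (insertMax (v , p , c)) ≡ rlminL L v + (if toℕ p ≡ᵇ n then indicator (Vec.lookup L c) else 0)
  rlminL-insertMax {n} v p c = begin
      rlminL' L (absCol (insertMax (v , p , c)))
    ≡⟨ cong (rlminL' L) (absCol-insertMax v p c) ⟩
      rlminL' L (insertAtℕ (toℕ p) (suc n , c) (absCol v))
    ≡⟨ rlminL'-insertAtℕ-max L (suc n) c (toℕ p) (absCol v) (absEntries-bounded v)
         (subst (toℕ p ≤_) (sym (length-absEntries v)) (toℕ≤pred[n] p)) ⟩
      rlminL L v + (if toℕ p ≡ᵇ length (absCol v) then indicator (Vec.lookup L c) else 0)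
    ≡⟨ cong (λ m → rlminL L v + (if toℕ p ≡ᵇ m then indicator (Vec.lookup L c) else 0)) (length-absEntries v) ⟩
      rlminL L v + (if toℕ p ≡ᵇ n then indicator (Vec.lookup L c) else 0) ∎
    where open ≡-Reasoning

  -- The inserted value n + 1 has key n + 1 (the L-largest) if c ∉ L and key -(n + 1) (the L-smallest) if c ∈ L.
  desL-insertMax : {n : ℕ} (v : Vec (Entry a n) n) (p : Fin (suc n)) (c : Fin a) →
    desL L (insertMax (v , p , c)) + descentAt (toℕ p) (keys v) ≡ desL L v + (if toℕ p ≡ᵇ n then indicator (Vec.lookup L c) else 1)
  desL-insertMax {n} v p c
    rewrite absCol-insertMax v p c | map-insertAtℕ (keyL L) (toℕ p) (suc n , c) (absCol v) = by-colour (Vec.lookup L c)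
    where
    ks = map (keyL L) (absCol v)
    p≤ : toℕ p ≤ length ks
    p≤ = subst (toℕ p ≤_) (sym (length-keys v)) (toℕ≤pred[n] p)
    by-colour : (inL : Bool) →
      descents (0ℤ ∷ insertAtℕ (toℕ p) (if inL then ℤ.- + suc n else + suc n) ks) + descentAt (toℕ p) (0ℤ ∷ ks)
        ≡ descents (0ℤ ∷ ks) + (if toℕ p ≡ᵇ n then indicator inL else 1)
    by-colour true  = trans (descents-insertAtℕ-min -[1+ n ] 0ℤ (toℕ p) ks (keys-above v) p≤)
      (cong (_+_ (descents (0ℤ ∷ ks))) (one (toℕ p ≡ᵇ n)))
      where
      one : ∀ b → 1 ≡ (if b then 1 else 1)
      one true  = refl
      one false = refl
    by-colour false = trans (descents-insertAtℕ-max (+ suc n) 0ℤ (toℕ p) ks (keys-below v) p≤)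
      (cong (λ m → descents (0ℤ ∷ ks) + (if toℕ p ≡ᵇ m then 0 else 1)) (length-keys v))

  descentAt-last : {n : ℕ} (v : Vec (Entry a n) n) (i : ℕ) → (i ≡ᵇ n) ≡ true → descentAt i (keys v) ≡ 0
  descentAt-last {n} v i i≡ᵇn rewrite ≡ᵇ⇒≡ i n (Equivalence.from T-≡ i≡ᵇn) =
    subst (λ m → descentAt m (keys v) ≡ 0) (length-keys v) (descentAt-length 0ℤ (map (keyL L) (absCol v)))

  rlminL≤desL-insertMax : {n : ℕ} (v : Vec (Entry a n) n) (p : Fin (suc n)) (c : Fin a) →
    rlminL L v ≤ desL L v → rlminL L (insertMax (v , p , c)) ≤ desL L (insertMax (v , p , c))
  rlminL≤desL-insertMax {n} v p c r≤d
    with toℕ p ≡ᵇ n in last | rlminL-insertMax v p c | desL-insertMax v p c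
  ... | true | r′≡ | d′+δ≡ = begin
      rlminL L (insertMax (v , p , c))
    ≡⟨ r′≡ ⟩
      rlminL L v + indicator (Vec.lookup L c)
    ≤⟨ +-monoˡ-≤ _ r≤d ⟩
      desL L v + indicator (Vec.lookup L c)
    ≡⟨ sym d′+δ≡ ⟩
      desL L (insertMax (v , p , c)) + descentAt (toℕ p) (keys v)
    ≡⟨ cong (_+_ (desL L (insertMax (v , p , c)))) (descentAt-last v (toℕ p) last) ⟩
      desL L (insertMax (v , p , c)) + 0
    ≡⟨ +-identityʳ _ ⟩
      desL L (insertMax (v , p , c)) ∎
    where open ≤-Reasoning
  ... | false | r′≡ | d′+δ≡ = begin
      rlminL L (insertMax (v , p , c))
    ≡⟨ trans r′≡ (+-identityʳ _) ⟩
      rlminL L v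
    ≤⟨ r≤d ⟩
      desL L v
    ≤⟨ +-cancelʳ-≤ 1 _ _ (≤-trans (≤-reflexive (sym d′+δ≡)) (+-monoʳ-≤ _ (descentAt≤1 (toℕ p) (keys v)))) ⟩
      desL L (insertMax (v , p , c)) ∎
    where open ≤-Reasoning

  rlminL≤desL : (n : ℕ) (w : Vec (Entry a n) n) → w ∈ colPerms a n → rlminL L w ≤ desL L w
  rlminL≤desL zero    Vec.[] _  = z≤n
  rlminL≤desL (suc n) w      w∈ with insertMax-surjective w (∈-colPerms⁻ w∈)
  ... | (v , p , c) , t∈ , refl =
    rlminL≤desL-insertMax v p c (rlminL≤desL n v (proj₁ (∈-cartesianProduct⁻ (colPerms a n) _ t∈)))

module _ {a : ℕ} where

  count-colPerms-suc-linear : (n : ℕ) (b : Vec (Entry a (suc n)) (suc n) → Bool) (x y : Vec (Entry a n) n → Bool) (ℓ C : ℕ) →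
    (∀ v → v ∈ colPerms a n →
       countInsertions b v + ℓ * indicator (x v)
         ≡ C * indicator (x v) + ℓ * indicator (y v)) →
    count b (colPerms a (suc n)) + ℓ * count x (colPerms a n) ≡ C * count x (colPerms a n) + ℓ * count y (colPerms a n)
  count-colPerms-suc-linear n b x y ℓ C per-v =
    trans (cong (_+ ℓ * count x (colPerms a n)) (count-colPerms-suc n b))
          (sum-map-linear (colPerms a n) _ (indicator ∘ x) (indicator ∘ y) ℓ C ℓ per-v)

module _ {a : ℕ} (L : Subset a) where

  private
    ℓ = ∣ L ∣

  count-rlminL-insertMax : {n : ℕ} (v : Vec (Entry a n) n) (p : Fin (suc n)) (m : ℕ) →
    count (λ c → rlminL L (insertMax (v , p , c)) ≡ᵇ m) (allFin a)
      ≡ (if toℕ p ≡ᵇ n then count (λ c → if Vec.lookup L c then suc (rlminL L v) ≡ᵇ m else rlminL L v ≡ᵇ m) (allFin a)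
                       else a * indicator (rlminL L v ≡ᵇ m))
  count-rlminL-insertMax {n} v p m with toℕ p ≡ᵇ n | (λ c → rlminL-insertMax L v p c)
  ... | true  | r′≡ = count-cong (allFin a) (λ c → trans (cong (_≡ᵇ m) (r′≡ c)) (by-colour (Vec.lookup L c)))
    where
    by-colour : ∀ inL → (rlminL L v + indicator inL ≡ᵇ m) ≡ (if inL then suc (rlminL L v) ≡ᵇ m else rlminL L v ≡ᵇ m)
    by-colour true  = cong (_≡ᵇ m) (+-comm (rlminL L v) 1)
    by-colour false = cong (_≡ᵇ m) (+-identityʳ (rlminL L v))
  ... | false | r′≡ = count-allFin-const a _ _ (λ c → cong (λ r → indicator (r ≡ᵇ m)) (trans (r′≡ c) (+-identityʳ _)))

  sum-count-rlminL-insertMax : {n : ℕ} (v : Vec (Entry a n) n) (m : ℕ) →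
    countInsertions (λ w → rlminL L w ≡ᵇ m) v + ℓ * indicator (rlminL L v ≡ᵇ m)
      ≡ suc n * a * indicator (rlminL L v ≡ᵇ m) + ℓ * indicator (suc (rlminL L v) ≡ᵇ m)
  sum-count-rlminL-insertMax {n} v m = begin
      countInsertions (λ w → rlminL L w ≡ᵇ m) v + ℓ * x
    ≡⟨ cong (λ s → sum s + ℓ * x) (map-cong (λ p → count-rlminL-insertMax v p m) (allFin (suc n))) ⟩
      sum (map (λ p → if toℕ p ≡ᵇ n then C else a * x) (allFin (suc n))) + ℓ * x
    ≡⟨ cong (_+ ℓ * x) (trans (sum-allFin-last n (λ _ → a * x) C) (cong (_+ C) (sum-applyUpTo-const n (a * x)))) ⟩
      n * (a * x) + C + ℓ * x
    ≡⟨ +-assoc (n * (a * x)) C (ℓ * x) ⟩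
      n * (a * x) + (C + ℓ * x)
    ≡⟨ cong (_+_ (n * (a * x))) (count-allFin-lookup-if a L (suc r ≡ᵇ m) (r ≡ᵇ m)) ⟩
      n * (a * x) + (ℓ * y + a * x)
    ≡⟨ regroup n a x y ℓ ⟩
      suc n * a * x + ℓ * y ∎
    where
    open ≡-Reasoning
    r = rlminL L v
    x = indicator (r ≡ᵇ m)
    y = indicator (suc r ≡ᵇ m)
    C = count (λ c → if Vec.lookup L c then suc r ≡ᵇ m else r ≡ᵇ m) (allFin a)
    regroup : ∀ n a x y ℓ → n * (a * x) + (ℓ * y + a * x) ≡ suc n * a * x + ℓ * y
    regroup = solve-∀

  countA≡count : (n m : ℕ) → countA a L n (+ m) ≡ count (λ w → rlminL L w ≡ᵇ m) (colPerms a n)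
  countA≡count n m = trans (length-filter-≡true _ (colPerms a n)) (count-cong (colPerms a n) (λ w → +-==ℤ-+ (rlminL L w) m))

  countA-negative : (n m : ℕ) → countA a L n -[1+ m ] ≡ 0
  countA-negative n m = trans (length-filter-≡true _ (colPerms a n)) (count-const-false (colPerms a n))

  countA-pred≡count : (n m : ℕ) → countA a L n (+ m - 1ℤ) ≡ count (λ w → suc (rlminL L w) ≡ᵇ m) (colPerms a n)
  countA-pred≡count n zero    = trans (countA-negative n 0) (sym (count-const-false (colPerms a n)))
  countA-pred≡count n (suc m) = countA≡count n m

  countA-recurrence : (n m : ℕ) →
    countA a L (suc n) (+ m) + ℓ * countA a L n (+ m) ≡ suc n * a * countA a L n (+ m) + ℓ * countA a L n (+ m - 1ℤ)
  countA-recurrence n m = begin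
      countA a L (suc n) (+ m) + ℓ * countA a L n (+ m)
    ≡⟨ cong₂ (λ s t → s + ℓ * t) (countA≡count (suc n) m) (countA≡count n m) ⟩
      count (λ w → rlminL L w ≡ᵇ m) (colPerms a (suc n)) + ℓ * count (λ w → rlminL L w ≡ᵇ m) (colPerms a n)
    ≡⟨ count-colPerms-suc-linear n _ _ _ ℓ (suc n * a) (λ v _ → sum-count-rlminL-insertMax v m) ⟩
      suc n * a * count (λ w → rlminL L w ≡ᵇ m) (colPerms a n) + ℓ * count (λ w → suc (rlminL L w) ≡ᵇ m) (colPerms a n)
    ≡⟨ sym (cong₂ (λ s t → suc n * a * s + ℓ * t) (countA≡count n m) (countA-pred≡count n m)) ⟩
      suc n * a * countA a L n (+ m) + ℓ * countA a L n (+ m - 1ℤ) ∎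
    where open ≡-Reasoning

  desL∧rlminL≡ᵇ : {n : ℕ} → ℕ → Vec (Entry a n) n → Bool
  desL∧rlminL≡ᵇ m w = (desL L w ≡ᵇ m) ∧ (rlminL L w ≡ᵇ m)

  count-desL∧rlminL-insertMax : {n : ℕ} (v : Vec (Entry a n) n) (p : Fin (suc n)) (m : ℕ) → rlminL L v ≤ desL L v →
    count (λ c → desL∧rlminL≡ᵇ m (insertMax (v , p , c))) (allFin a)
      ≡ (if toℕ p ≡ᵇ n
         then count (λ c → if Vec.lookup L c then (suc (desL L v) ≡ᵇ m) ∧ (suc (rlminL L v) ≡ᵇ m) else desL∧rlminL≡ᵇ m v)
                    (allFin a)
         else a * (indicator (desL∧rlminL≡ᵇ m v) * descentAt (toℕ p) (keys L v)))
  count-desL∧rlminL-insertMax {n} v p m r≤d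
    with toℕ p ≡ᵇ n in last | (λ c → rlminL-insertMax L v p c) | (λ c → desL-insertMax L v p c)
  ... | true  | r′≡ | d′+δ≡ = count-cong (allFin a) (λ c →
          trans (cong₂ (λ d′ r′ → (d′ ≡ᵇ m) ∧ (r′ ≡ᵇ m)) (d′≡ c) (r′≡ c)) (by-colour (Vec.lookup L c)))
    where
    d′≡ : ∀ c → desL L (insertMax (v , p , c)) ≡ desL L v + indicator (Vec.lookup L c)
    d′≡ c = trans (sym (+-identityʳ _))
      (trans (cong (_+_ (desL L (insertMax (v , p , c)))) (sym (descentAt-last L v (toℕ p) last))) (d′+δ≡ c))
    by-colour : ∀ inL → ((desL L v + indicator inL ≡ᵇ m) ∧ (rlminL L v + indicator inL ≡ᵇ m))
                      ≡ (if inL then (suc (desL L v) ≡ᵇ m) ∧ (suc (rlminL L v) ≡ᵇ m) else desL∧rlminL≡ᵇ m v)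
    by-colour true  = cong₂ (λ d r → (d ≡ᵇ m) ∧ (r ≡ᵇ m)) (+-comm (desL L v) 1) (+-comm (rlminL L v) 1)
    by-colour false = cong₂ (λ d r → (d ≡ᵇ m) ∧ (r ≡ᵇ m)) (+-identityʳ (desL L v)) (+-identityʳ (rlminL L v))
  ... | false | r′≡ | d′+δ≡ = count-allFin-const a _ _ (λ c →
          by-descent (descentAt (toℕ p) (keys L v)) (descentAt≤1 (toℕ p) (keys L v)) (trans (r′≡ c) (+-identityʳ _)) (d′+δ≡ c))
    where
    -- Inserting in front of a non-descent creates a new descent, which rlminL ≤ desL rules out.
    by-descent : ∀ {d′ r′} δ → δ ≤ 1 → r′ ≡ rlminL L v → d′ + δ ≡ desL L v + 1 →
      indicator ((d′ ≡ᵇ m) ∧ (r′ ≡ᵇ m)) ≡ indicator (desL∧rlminL≡ᵇ m v) * δ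
    by-descent {d′} zero _ refl d′≡ rewrite trans (sym (+-identityʳ d′)) (trans d′≡ (+-comm (desL L v) 1))
                                          | *-zeroʳ (indicator (desL∧rlminL≡ᵇ m v)) =
      cong indicator (suc≡ᵇ∧≡ᵇ-false r≤d)
      where
      suc≡ᵇ∧≡ᵇ-false : ∀ {r d} → r ≤ d → (suc d ≡ᵇ m) ∧ (r ≡ᵇ m) ≡ false
      suc≡ᵇ∧≡ᵇ-false {r} {d} r≤d with r ≡ᵇ m in r≡ᵇm
      ... | false = ∧-zeroʳ (suc d ≡ᵇ m)
      ... | true rewrite sym (≡ᵇ⇒≡ r m (Equivalence.from T-≡ r≡ᵇm)) | ≡ᵇ-sym (suc d) r =
        cong (_∧ true) (<⇒≡ᵇ≡false (s≤s r≤d))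
    by-descent {d′} (suc zero) _ refl d′≡ rewrite +-cancelʳ-≡ 1 d′ (desL L v) d′≡ = sym (*-identityʳ _)
    by-descent (suc (suc _)) (s≤s ()) _ _

  sum-count-desL∧rlminL-insertMax : {n : ℕ} (v : Vec (Entry a n) n) (m : ℕ) → rlminL L v ≤ desL L v →
    countInsertions (desL∧rlminL≡ᵇ m) v + ℓ * indicator (desL∧rlminL≡ᵇ m v)
      ≡ (a * m + a) * indicator (desL∧rlminL≡ᵇ m v) + ℓ * indicator ((suc (desL L v) ≡ᵇ m) ∧ (suc (rlminL L v) ≡ᵇ m))
  sum-count-desL∧rlminL-insertMax {n} v m r≤d = begin
      countInsertions (desL∧rlminL≡ᵇ m) v + ℓ * x
    ≡⟨ cong (λ s → sum s + ℓ * x) (map-cong (λ p → count-desL∧rlminL-insertMax v p m r≤d) (allFin (suc n))) ⟩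
      sum (map (λ p → if toℕ p ≡ᵇ n then C else a * (x * descentAt (toℕ p) (keys L v))) (allFin (suc n))) + ℓ * x
    ≡⟨ cong (_+ ℓ * x) (sum-allFin-last n (λ i → a * (x * descentAt i (keys L v))) C) ⟩
      sum (applyUpTo (λ i → a * (x * descentAt i (keys L v))) n) + C + ℓ * x
    ≡⟨ cong (λ s → s + C + ℓ * x) (trans (sum-applyUpTo-*ˡ n a _) (cong (a *_) (sum-applyUpTo-*ˡ n x _))) ⟩
      a * (x * sum (applyUpTo (λ i → descentAt i (keys L v)) n)) + C + ℓ * x
    ≡⟨ cong (λ s → a * (x * s) + C + ℓ * x) sum-descents ⟩
      a * (x * d) + C + ℓ * x
    ≡⟨ cong (λ s → a * s + C + ℓ * x) (indicator-≡ᵇ∧-* d m (r ≡ᵇ m)) ⟩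
      a * (x * m) + C + ℓ * x
    ≡⟨ +-assoc (a * (x * m)) C (ℓ * x) ⟩
      a * (x * m) + (C + ℓ * x)
    ≡⟨ cong (_+_ (a * (x * m))) (count-allFin-lookup-if a L ((suc d ≡ᵇ m) ∧ (suc r ≡ᵇ m)) (desL∧rlminL≡ᵇ m v)) ⟩
      a * (x * m) + (ℓ * y + a * x)
    ≡⟨ regroup a m x y ℓ ⟩
      (a * m + a) * x + ℓ * y ∎
    where
    open ≡-Reasoning
    r = rlminL L v
    d = desL L v
    x = indicator (desL∧rlminL≡ᵇ m v)
    y = indicator ((suc d ≡ᵇ m) ∧ (suc r ≡ᵇ m))
    C = count (λ c → if Vec.lookup L c then (suc d ≡ᵇ m) ∧ (suc r ≡ᵇ m) else desL∧rlminL≡ᵇ m v) (allFin a)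
    sum-descents : sum (applyUpTo (λ i → descentAt i (keys L v)) n) ≡ d
    sum-descents = subst (λ k → sum (applyUpTo (λ i → descentAt i (keys L v)) k) ≡ d) (length-keys L v)
      (sum-descentAt 0ℤ (map (keyL L) (absCol v)))
    indicator-≡ᵇ∧-* : ∀ d m b → indicator ((d ≡ᵇ m) ∧ b) * d ≡ indicator ((d ≡ᵇ m) ∧ b) * m
    indicator-≡ᵇ∧-* d m b with d ≡ᵇ m in d≡ᵇm
    ... | false = refl
    ... | true  = cong (indicator b *_) (≡ᵇ⇒≡ d m (Equivalence.from T-≡ d≡ᵇm))
    regroup : ∀ a m x y ℓ → a * (x * m) + (ℓ * y + a * x) ≡ (a * m + a) * x + ℓ * y
    regroup = solve-∀

  countB≡count : (n m : ℕ) → countB a L n (+ m) ≡ count (desL∧rlminL≡ᵇ m) (colPerms a n)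
  countB≡count n m = trans (length-filter-≡true _ (colPerms a n))
    (count-cong (colPerms a n) (λ w → cong₂ _∧_ (+-==ℤ-+ (desL L w) m) (+-==ℤ-+ (rlminL L w) m)))

  countB-negative : (n m : ℕ) → countB a L n -[1+ m ] ≡ 0
  countB-negative n m = trans (length-filter-≡true _ (colPerms a n)) (count-const-false (colPerms a n))

  countB-pred≡count : (n m : ℕ) →
    countB a L n (+ m - 1ℤ) ≡ count (λ w → (suc (desL L w) ≡ᵇ m) ∧ (suc (rlminL L w) ≡ᵇ m)) (colPerms a n)
  countB-pred≡count n zero    = trans (countB-negative n 0) (sym (count-const-false (colPerms a n)))
  countB-pred≡count n (suc m) = countB≡count n m

  countB-recurrence : (n m : ℕ) →
    countB a L (suc n) (+ m) + ℓ * countB a L n (+ m) ≡ (a * m + a) * countB a L n (+ m) + ℓ * countB a L n (+ m - 1ℤ)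
  countB-recurrence n m = begin
      countB a L (suc n) (+ m) + ℓ * countB a L n (+ m)
    ≡⟨ cong₂ (λ s t → s + ℓ * t) (countB≡count (suc n) m) (countB≡count n m) ⟩
      count (desL∧rlminL≡ᵇ m) (colPerms a (suc n)) + ℓ * count (desL∧rlminL≡ᵇ m) (colPerms a n)
    ≡⟨ count-colPerms-suc-linear n _ _ _ ℓ (a * m + a)
         (λ v v∈ → sum-count-desL∧rlminL-insertMax v m (rlminL≤desL L n v v∈)) ⟩
      (a * m + a) * count (desL∧rlminL≡ᵇ m) (colPerms a n)
        + ℓ * count (λ w → (suc (desL L w) ≡ᵇ m) ∧ (suc (rlminL L w) ≡ᵇ m)) (colPerms a n)
    ≡⟨ sym (cong₂ (λ s t → (a * m + a) * s + ℓ * t) (countB≡count n m) (countB-pred≡count n m)) ⟩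
      (a * m + a) * countB a L n (+ m) + ℓ * countB a L n (+ m - 1ℤ) ∎
    where open ≡-Reasoning

g-vanishes-above : (A D R Λ : ℤ) (n m : ℕ) → n < m → g A D R Λ n (+ m) ≡ 0ℤ
g-vanishes-above A D R Λ zero    (suc m) _   = refl
g-vanishes-above A D R Λ (suc n) m       n<m with m ℕ.≤ᵇ suc n in m≤ᵇn
... | false = refl
... | true  = contradiction (≤ᵇ⇒≤ m (suc n) (Equivalence.from T-≡ m≤ᵇn)) (<⇒≱ n<m)

solve-for-+ : (X Y C ℓ W : ℕ) → X + ℓ * Y ≡ C * Y + ℓ * W → + X ≡ (+ C - + ℓ) ℤ.* + Y ℤ.+ + ℓ ℤ.* + W
solve-for-+ X Y C ℓ W rel = begin
    + X
  ≡⟨ add-sub (+ X) (+ ℓ ℤ.* + Y) ⟩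
    + X ℤ.+ + ℓ ℤ.* + Y - + ℓ ℤ.* + Y
  ≡⟨ cong (_- + ℓ ℤ.* + Y) lifted ⟩
    + C ℤ.* + Y ℤ.+ + ℓ ℤ.* + W - + ℓ ℤ.* + Y
  ≡⟨ regroup (+ C) (+ Y) (+ ℓ) (+ W) ⟩
    (+ C - + ℓ) ℤ.* + Y ℤ.+ + ℓ ℤ.* + W ∎
  where
  open ≡-Reasoning
  add-sub : ∀ x z → x ≡ x ℤ.+ z - z
  add-sub = ℤ-solve
  regroup : ∀ c y l w → c ℤ.* y ℤ.+ l ℤ.* w - l ℤ.* y ≡ (c - l) ℤ.* y ℤ.+ l ℤ.* w
  regroup = ℤ-solve
  lifted : + X ℤ.+ + ℓ ℤ.* + Y ≡ + C ℤ.* + Y ℤ.+ + ℓ ℤ.* + W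
  lifted = begin
      + X ℤ.+ + ℓ ℤ.* + Y
    ≡⟨ cong (ℤ._+_ (+ X)) (sym (ℤ.pos-* ℓ Y)) ⟩
      + X ℤ.+ + (ℓ * Y)
    ≡⟨ sym (ℤ.pos-+ X (ℓ * Y)) ⟩
      + (X + ℓ * Y)
    ≡⟨ cong +_ rel ⟩
      + (C * Y + ℓ * W)
    ≡⟨ ℤ.pos-+ (C * Y) (ℓ * W) ⟩
      + (C * Y) ℤ.+ + (ℓ * W)
    ≡⟨ cong₂ ℤ._+_ (ℤ.pos-* C Y) (ℤ.pos-* ℓ W) ⟩
      + C ℤ.* + Y ℤ.+ + ℓ ℤ.* + W ∎

module _ (A D R : ℤ) (ℓ : ℕ) (C : ℕ → ℕ → ℕ) (F : ℕ → ℤ → ℕ)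
  (coefficient : ∀ n m → A ℤ.* + suc n ℤ.+ D ℤ.* + m - R ≡ + C n m - + ℓ)
  (initial : ∀ k → g A D R (+ ℓ) 0 k ≡ + F 0 k)
  (negative : ∀ n m → F n -[1+ m ] ≡ 0)
  (recurrence : ∀ n m → F (suc n) (+ m) + ℓ * F n (+ m) ≡ C n m * F n (+ m) + ℓ * F n (+ m - 1ℤ))
  where

  g≡F : ∀ n k → g A D R (+ ℓ) n k ≡ + F n k
  g≡F zero    k        = initial k
  g≡F (suc n) -[1+ m ] = cong +_ (sym (negative (suc n) m))
  g≡F (suc n) (+ m) with m ℕ.≤ᵇ suc n in m≤ᵇn
  ... | true = begin
      (A ℤ.* + suc n ℤ.+ D ℤ.* + m - R) ℤ.* g A D R (+ ℓ) n (+ m) ℤ.+ + ℓ ℤ.* g A D R (+ ℓ) n (+ m - 1ℤ)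
    ≡⟨ cong₂ (λ s t → s ℤ.* t ℤ.+ + ℓ ℤ.* g A D R (+ ℓ) n (+ m - 1ℤ)) (coefficient n m) (g≡F n (+ m)) ⟩
      (+ C n m - + ℓ) ℤ.* + F n (+ m) ℤ.+ + ℓ ℤ.* g A D R (+ ℓ) n (+ m - 1ℤ)
    ≡⟨ cong (λ t → (+ C n m - + ℓ) ℤ.* + F n (+ m) ℤ.+ + ℓ ℤ.* t) (g≡F n (+ m - 1ℤ)) ⟩
      (+ C n m - + ℓ) ℤ.* + F n (+ m) ℤ.+ + ℓ ℤ.* + F n (+ m - 1ℤ)
    ≡⟨ sym (solve-for-+ _ _ (C n m) ℓ _ (recurrence n m)) ⟩
      + F (suc n) (+ m) ∎
    where open ≡-Reasoning
  ... | false = cong +_ (sym (vanishes m (≰⇒> (λ m≤ → subst T m≤ᵇn (≤⇒≤ᵇ m≤)))))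
    where
    F-vanishes : ∀ k → n < k → F n (+ k) ≡ 0
    F-vanishes k n<k = ℤ.+-injective (trans (sym (g≡F n (+ k))) (g-vanishes-above A D R (+ ℓ) n k n<k))
    vanishes : ∀ m → suc n < m → F (suc n) (+ m) ≡ 0
    vanishes (suc k) (s≤s n<k) with recurrence n (suc k)
    ... | rel rewrite F-vanishes (suc k) (m<n⇒m<1+n n<k) | F-vanishes k n<k
                    | *-zeroʳ ℓ | *-zeroʳ (C n (suc k)) | +-identityʳ (F (suc n) (+ suc k)) = rel

module _ {a : ℕ} (L : Subset a) (A D R Λ : ℤ) where

  g-zero≡countA : ∀ k → g A D R Λ 0 k ≡ + countA a L 0 k
  g-zero≡countA (+ zero)  = refl
  g-zero≡countA (+ suc _) = refl
  g-zero≡countA -[1+ _ ]  = refl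

  g-zero≡countB : ∀ k → g A D R Λ 0 k ≡ + countB a L 0 k
  g-zero≡countB (+ zero)  = refl
  g-zero≡countB (+ suc _) = refl
  g-zero≡countB -[1+ _ ]  = refl

coefficientA : (a ℓ n m : ℕ) → + a ℤ.* + suc n ℤ.+ 0ℤ ℤ.* + m - + ℓ ≡ + (suc n * a) - + ℓ
coefficientA a ℓ n m = trans (regroup (+ a) (+ suc n) (+ m) (+ ℓ)) (cong (_- + ℓ) (sym (ℤ.pos-* (suc n) a)))
  where
  regroup : ∀ a s m l → a ℤ.* s ℤ.+ 0ℤ ℤ.* m - l ≡ s ℤ.* a - l
  regroup = ℤ-solve

coefficientB : (a ℓ n m : ℕ) → 0ℤ ℤ.* + suc n ℤ.+ + a ℤ.* + m - (+ ℓ - + a) ≡ + (a * m + a) - + ℓ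
coefficientB a ℓ n m =
  trans (regroup (+ a) (+ suc n) (+ m) (+ ℓ)) (cong (_- + ℓ) (sym (trans (ℤ.pos-+ (a * m) a) (cong (ℤ._+ + a) (ℤ.pos-* a m)))))
  where
  regroup : ∀ a s m l → 0ℤ ℤ.* s ℤ.+ a ℤ.* m - (l - a) ≡ a ℤ.* m ℤ.+ a - l
  regroup = ℤ-solve

theorem1p1 : (a : ℕ) → 1 ≤ a → (L : Subset a) → (n : ℕ) → (k : ℤ) →
    (g (+ a) 0ℤ (+ ∣ L ∣) (+ ∣ L ∣) n k ≡ + countA a L n k)
    × (g 0ℤ (+ a) (+ ∣ L ∣ - + a) (+ ∣ L ∣) n k ≡ + countB a L n k)
theorem1p1 a _ L n k =
    g≡F (+ a) 0ℤ (+ ℓ) ℓ (λ n _ → suc n * a) (countA a L)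
      (coefficientA a ℓ) (g-zero≡countA L (+ a) 0ℤ (+ ℓ) (+ ℓ)) (countA-negative L) (countA-recurrence L) n k
  , g≡F 0ℤ (+ a) (+ ℓ - + a) ℓ (λ _ m → a * m + a) (countB a L)
      (coefficientB a ℓ) (g-zero≡countB L 0ℤ (+ a) (+ ℓ - + a) (+ ℓ)) (countB-negative L) (countB-recurrence L) n k
  where
  ℓ = ∣ L ∣
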